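{- Let $m$ be a positive integer and let $A,B,C$ be finite sets with $|A|+|B|\ge |C|+m$. Then there exist sets $S\subseteq A\setminus C$, $T\subseteq B\setminus C$ and $R\subseteq A\cap B\cap C$ such that $|S|+|T|+|R|=m$. -}

module Defs where

{-# OPTIONS --safe #-}
-- Splitting A and B along C gives |A| + |B| = |A ─ C| + |B ─ C| + |A ∩ C| + |B ∩ C|, and by
-- inclusion–exclusion |A ∩ C| + |B ∩ C| ≤ |C| + |A ∩ B ∩ C|.  Hence the three sets A ─ C,
-- B ─ C and A ∩ B ∩ C have total size at least m, so m can be distributed among them, and
-- each of them has subsets of every size up to its own.
module Submission where

open import Defs
open import Data.Nat using (ℕ; zero; suc; _+_; _∸_; _⊓_; _≤_; _≥_; s≤s; NonZero)
open import Data.Nat.Properties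
  using (+-suc; +-mono-≤; +-monoʳ-≤; +-cancelˡ-≤; ≤-trans; m⊓n≤m; m⊓n+n∸m≡n; m≤n+o⇒m∸n≤o;
         +-commutativeSemigroup; module ≤-Reasoning)
open import Algebra.Properties.CommutativeSemigroup +-commutativeSemigroup
  using (interchange; x∙yz≈y∙xz)
open import Data.Fin.Subset using (Subset; _⊆_; _∩_; _∪_; _─_; ∣_∣; ⊥; inside; outside)
open import Data.Fin.Subset.Properties
  using (⊥⊆; ∣⊥∣≡0; out⊆; in⊆in; p⊆q⇒∣p∣≤∣q∣; p∩q⊆p; p∩q⊆q; x∈p∩q⁺; x∈p∩q⁻; x∈p∪q⁻)
open import Data.Vec using ([]; _∷_)
open import Data.Product using (Σ-syntax; ∃₂; _×_; _,_)
open import Data.Sum using ([_,_])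
open import Relation.Binary.PropositionalEquality using (_≡_; refl; cong; cong₂; sym; trans)

private variable n : ℕ

∣p∣≡∣p─q∣+∣p∩q∣ : ∀ (p q : Subset n) → ∣ p ∣ ≡ ∣ p ─ q ∣ + ∣ p ∩ q ∣
∣p∣≡∣p─q∣+∣p∩q∣ []            []            = refl
∣p∣≡∣p─q∣+∣p∩q∣ (inside  ∷ p) (inside  ∷ q) =
  trans (cong suc (∣p∣≡∣p─q∣+∣p∩q∣ p q)) (sym (+-suc _ _))
∣p∣≡∣p─q∣+∣p∩q∣ (inside  ∷ p) (outside ∷ q) = cong suc (∣p∣≡∣p─q∣+∣p∩q∣ p q)
∣p∣≡∣p─q∣+∣p∩q∣ (outside ∷ p) (inside  ∷ q) = ∣p∣≡∣p─q∣+∣p∩q∣ p q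
∣p∣≡∣p─q∣+∣p∩q∣ (outside ∷ p) (outside ∷ q) = ∣p∣≡∣p─q∣+∣p∩q∣ p q

∣p∣+∣q∣≡∣p∪q∣+∣p∩q∣ : ∀ (p q : Subset n) → ∣ p ∣ + ∣ q ∣ ≡ ∣ p ∪ q ∣ + ∣ p ∩ q ∣
∣p∣+∣q∣≡∣p∪q∣+∣p∩q∣ []            []            = refl
∣p∣+∣q∣≡∣p∪q∣+∣p∩q∣ (inside  ∷ p) (inside  ∷ q) =
  cong suc (trans (+-suc _ _) (trans (cong suc (∣p∣+∣q∣≡∣p∪q∣+∣p∩q∣ p q)) (sym (+-suc _ _))))
∣p∣+∣q∣≡∣p∪q∣+∣p∩q∣ (inside  ∷ p) (outside ∷ q) = cong suc (∣p∣+∣q∣≡∣p∪q∣+∣p∩q∣ p q)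
∣p∣+∣q∣≡∣p∪q∣+∣p∩q∣ (outside ∷ p) (inside  ∷ q) =
  trans (+-suc _ _) (cong suc (∣p∣+∣q∣≡∣p∪q∣+∣p∩q∣ p q))
∣p∣+∣q∣≡∣p∪q∣+∣p∩q∣ (outside ∷ p) (outside ∷ q) = ∣p∣+∣q∣≡∣p∪q∣+∣p∩q∣ p q

∣p∩r∣+∣q∩r∣≤∣r∣+∣p∩q∩r∣ : ∀ (p q r : Subset n) → ∣ p ∩ r ∣ + ∣ q ∩ r ∣ ≤ ∣ r ∣ + ∣ p ∩ q ∩ r ∣
∣p∩r∣+∣q∩r∣≤∣r∣+∣p∩q∩r∣ p q r = begin
  ∣ p ∩ r ∣ + ∣ q ∩ r ∣
    ≡⟨ ∣p∣+∣q∣≡∣p∪q∣+∣p∩q∣ (p ∩ r) (q ∩ r) ⟩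
  ∣ p ∩ r ∪ q ∩ r ∣ + ∣ (p ∩ r) ∩ q ∩ r ∣
    ≤⟨ +-mono-≤ (p⊆q⇒∣p∣≤∣q∣ p∩r∪q∩r⊆r) (p⊆q⇒∣p∣≤∣q∣ p∩r∩q∩r⊆p∩q∩r) ⟩
  ∣ r ∣ + ∣ p ∩ q ∩ r ∣ ∎
  where
  open ≤-Reasoning

  p∩r∪q∩r⊆r : p ∩ r ∪ q ∩ r ⊆ r
  p∩r∪q∩r⊆r x∈ = [ p∩q⊆q p r , p∩q⊆q q r ] (x∈p∪q⁻ (p ∩ r) (q ∩ r) x∈)

  p∩r∩q∩r⊆p∩q∩r : (p ∩ r) ∩ q ∩ r ⊆ p ∩ q ∩ r
  p∩r∩q∩r⊆p∩q∩r x∈ with x∈p∩q⁻ (p ∩ r) (q ∩ r) x∈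
  ... | x∈p∩r , x∈q∩r = x∈p∩q⁺ (p∩q⊆p p r x∈p∩r , x∈q∩r)

∣p∣+∣q∣≤∣r∣+∣p─r∣+∣q─r∣+∣p∩q∩r∣ : ∀ (p q r : Subset n) →
  ∣ p ∣ + ∣ q ∣ ≤ ∣ r ∣ + (∣ p ─ r ∣ + ∣ q ─ r ∣ + ∣ p ∩ q ∩ r ∣)
∣p∣+∣q∣≤∣r∣+∣p─r∣+∣q─r∣+∣p∩q∩r∣ p q r = begin
  ∣ p ∣ + ∣ q ∣
    ≡⟨ cong₂ _+_ (∣p∣≡∣p─q∣+∣p∩q∣ p r) (∣p∣≡∣p─q∣+∣p∩q∣ q r) ⟩
  (∣ p ─ r ∣ + ∣ p ∩ r ∣) + (∣ q ─ r ∣ + ∣ q ∩ r ∣)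
    ≡⟨ interchange (∣ p ─ r ∣) (∣ p ∩ r ∣) (∣ q ─ r ∣) (∣ q ∩ r ∣) ⟩
  (∣ p ─ r ∣ + ∣ q ─ r ∣) + (∣ p ∩ r ∣ + ∣ q ∩ r ∣)
    ≤⟨ +-monoʳ-≤ (∣ p ─ r ∣ + ∣ q ─ r ∣) (∣p∩r∣+∣q∩r∣≤∣r∣+∣p∩q∩r∣ p q r) ⟩
  (∣ p ─ r ∣ + ∣ q ─ r ∣) + (∣ r ∣ + ∣ p ∩ q ∩ r ∣)
    ≡⟨ x∙yz≈y∙xz (∣ p ─ r ∣ + ∣ q ─ r ∣) (∣ r ∣) (∣ p ∩ q ∩ r ∣) ⟩
  ∣ r ∣ + (∣ p ─ r ∣ + ∣ q ─ r ∣ + ∣ p ∩ q ∩ r ∣) ∎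
  where open ≤-Reasoning

≤-+-split : ∀ {m a b} → m ≤ a + b → ∃₂ λ x y → x ≤ a × y ≤ b × x + y ≡ m
≤-+-split {m} {a} m≤a+b = a ⊓ m , m ∸ a , m⊓n≤m a m , m≤n+o⇒m∸n≤o m a m≤a+b , m⊓n+n∸m≡n a m

⊆-of-size : ∀ {k} (p : Subset n) → k ≤ ∣ p ∣ → Σ[ q ∈ Subset n ] q ⊆ p × ∣ q ∣ ≡ k
⊆-of-size {n} {zero}  p             _           = ⊥ , ⊥⊆ , ∣⊥∣≡0 n
⊆-of-size {_} {suc k} (outside ∷ p) k≤∣p∣       with ⊆-of-size p k≤∣p∣
... | q , q⊆p , ∣q∣≡k = outside ∷ q , out⊆ q⊆p , ∣q∣≡k
⊆-of-size {_} {suc k} (inside  ∷ p) (s≤s k≤∣p∣) with ⊆-of-size p k≤∣p∣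
... | q , q⊆p , ∣q∣≡k = inside ∷ q , in⊆in q⊆p , cong suc ∣q∣≡k

⊆-of-sizes-summing-to : ∀ {m} (p q r : Subset n) → m ≤ ∣ p ∣ + ∣ q ∣ + ∣ r ∣ →
  Σ[ S ∈ Subset n ] Σ[ T ∈ Subset n ] Σ[ R ∈ Subset n ]
    S ⊆ p × T ⊆ q × R ⊆ r × ∣ S ∣ + ∣ T ∣ + ∣ R ∣ ≡ m
⊆-of-sizes-summing-to p q r m≤
  with s , z , s≤ , z≤ , s+z≡m ← ≤-+-split m≤
  with x , y , x≤ , y≤ , x+y≡s ← ≤-+-split s≤
  with S , S⊆p , refl ← ⊆-of-size p x≤
  with T , T⊆q , refl ← ⊆-of-size q y≤
  with R , R⊆r , refl ← ⊆-of-size r z≤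
  = S , T , R , S⊆p , T⊆q , R⊆r , trans (cong (_+ ∣ R ∣) x+y≡s) s+z≡m

-- The statement also holds for m = 0.
lemma2p2 : (n m : ℕ) → .{{_ : NonZero m}} → (A B C : Subset n) →
    ∣ A ∣ + ∣ B ∣ ≥ ∣ C ∣ + m →
    Σ[ S ∈ Subset n ] Σ[ T ∈ Subset n ] Σ[ R ∈ Subset n ]
      (S ⊆ A ─ C) × (T ⊆ B ─ C) × (R ⊆ A ∩ B ∩ C) × (∣ S ∣ + ∣ T ∣ + ∣ R ∣ ≡ m)
lemma2p2 n m A B C ∣C∣+m≤∣A∣+∣B∣ = ⊆-of-sizes-summing-to (A ─ C) (B ─ C) (A ∩ B ∩ C)
    m≤∣A─C∣+∣B─C∣+∣A∩B∩C∣
  where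
  m≤∣A─C∣+∣B─C∣+∣A∩B∩C∣ : m ≤ ∣ A ─ C ∣ + ∣ B ─ C ∣ + ∣ A ∩ B ∩ C ∣
  m≤∣A─C∣+∣B─C∣+∣A∩B∩C∣ =
    +-cancelˡ-≤ ∣ C ∣ _ _ (≤-trans ∣C∣+m≤∣A∣+∣B∣ (∣p∣+∣q∣≤∣r∣+∣p─r∣+∣q─r∣+∣p∩q∩r∣ A B C))
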